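{- Let $E$ be a finite set and let $(E,\mathcal{F})$ be an accessible set system whose extreme point operator $ex$ satisfies the heritage property. Let $\pi:E\times2^E\to\mathbf{R}$ be a monotone linkage function, and let $F=F_\pi:\mathcal{F}\to\mathbf{R}$ be given by $F(X)=\min_{x\in ex(X)}\pi(x,X)$ for nonempty $X\in\mathcal{F}$ and $F(\varnothing)=\min_{(x,X)\in E\times2^E}\pi(x,X)$. Define $\pi_F(x,X)=\max_{A\in[x,X]_{\mathcal{F}}}F(A)$ if $x\in X$ and $[x,X]_{\mathcal{F}}\neq\varnothing$, and $\pi_F(x,X)=\min_{A\in\mathcal{F}}F(A)$ otherwise, where $[x,X]_{\mathcal{F}}=\{A\in\mathcal{F}: x\in A,\ A\subseteq X\}$. Then for all $X\in\mathcal{F}$ and all $x\in ex(X)$, $\pi_F(x,X)\leq\pi(x,X)$.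
   Context: A nonempty set system $(E,\mathcal{F})$ is accessible if for every nonempty $X\in\mathcal{F}$ there is $x\in X$ with $X-\{x\}\in\mathcal{F}$. For $X\in\mathcal{F}$, $ex(X)=\{x\in X: X-\{x\}\in\mathcal{F}\}$. The operator $ex$ satisfies the heritage property if $X\subseteq Y$ implies $ex(Y)\cap X\subseteq ex(X)$ for all $X,Y\in\mathcal{F}$. A monotone linkage function is $\pi:E\times2^E\to\mathbf{R}$ with $\pi(x,X)\leq\pi(x,Y)$ whenever $X\subseteq Y\subseteq E$, $x\in E$. -}

module Defs where

open import Level using (Level)
open import Data.Bool using (Bool; true; false; T; _∧_; if_then_else_)
open import Data.Nat using (ℕ; suc)
open import Data.Fin using (Fin; zero)
open import Data.Fin.Subset using (Subset; _∈_; _⊆_; _-_; ⊥; Nonempty)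
open import Data.Fin.Subset.Properties using (_∈?_; _⊆?_; nonempty?)
open import Data.List using (List; []; _∷_; _++_; map; filterᵇ; concatMap; foldr)
open import Data.List.Base using (allFin)
open import Data.Vec using (Vec) renaming ([] to []ᵥ; _∷_ to _∷ᵥ_)
open import Data.Product using (_×_; _,_; ∃; ∃-syntax)
open import Relation.Nullary using (¬_; does)
open import Relation.Binary.Bundles using (DecTotalOrder)

allSubsets : (n : ℕ) → List (Subset n)
allSubsets ℕ.zero = []ᵥ ∷ []
allSubsets (suc n) = map (true ∷ᵥ_) (allSubsets n) ++ map (false ∷ᵥ_) (allSubsets n)

module SetSystem {n : ℕ} (𝓕 : Subset n → Bool) where

  _∈𝓕 : Subset n → Set
  X ∈𝓕 = T (𝓕 X)

  _∈ex_ : Fin n → Subset n → Set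
  x ∈ex X = x ∈ X × (X - x) ∈𝓕

  NonemptySystem : Set
  NonemptySystem = ∃[ X ] X ∈𝓕

  Accessible : Set
  Accessible = ∀ X → X ∈𝓕 → Nonempty X → ∃[ x ] (x ∈ X × (X - x) ∈𝓕)

  Heritage : Set
  Heritage = ∀ X Y → X ∈𝓕 → Y ∈𝓕 → X ⊆ Y → ∀ x → x ∈ex Y → x ∈ X → x ∈ex X

  familyList : List (Subset n)
  familyList = filterᵇ 𝓕 (allSubsets n)

  exList : Subset n → List (Fin n)
  exList X = filterᵇ (λ x → does (x ∈? X) ∧ 𝓕 (X - x)) (allFin n)

  intervalList : Fin n → Subset n → List (Subset n)
  intervalList x X = filterᵇ (λ A → does (x ∈? A) ∧ does (A ⊆? X)) familyList

module Linkage {c ℓ₁ ℓ₂ : Level} (O : DecTotalOrder c ℓ₁ ℓ₂) where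
  open DecTotalOrder O renaming (Carrier to R)

  _⊓_ : R → R → R
  a ⊓ b = if does (a ≤? b) then a else b

  _⊔_ : R → R → R
  a ⊔ b = if does (a ≤? b) then b else a

  minOr : R → List R → R
  minOr d [] = d
  minOr d (a ∷ as) = foldr _⊓_ a as

  maxOr : R → List R → R
  maxOr d [] = d
  maxOr d (a ∷ as) = foldr _⊔_ a as

  Monotone : {n : ℕ} → (Fin n → Subset n → R) → Set _
  Monotone {n} π = ∀ (x : Fin n) (X Y : Subset n) → X ⊆ Y → π x X ≤ π x Y

  -- E = Fin (suc m) is nonempty, so E × 2^E is nonempty
  module Construction {m : ℕ} (𝓕 : Subset (suc m) → Bool)
                      (π : Fin (suc m) → Subset (suc m) → R) where
    open SetSystem 𝓕

    globalMin : R
    globalMin = minOr (π zero ⊥)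
      (concatMap (λ x → map (π x) (allSubsets (suc m))) (allFin (suc m)))

    F : Subset (suc m) → R
    F X with nonempty? X
    ... | Relation.Nullary.yes _ = minOr globalMin (map (λ x → π x X) (exList X))
    ... | Relation.Nullary.no  _ = globalMin

    minF : R
    minF = minOr globalMin (map F familyList)

    πF : Fin (suc m) → Subset (suc m) → R
    πF x X with does (x ∈? X) | intervalList x X
    ... | true  | A ∷ As = maxOr minF (map F (A ∷ As))
    ... | true  | []     = minF
    ... | false | _      = minF

-- For A ∈ [x, X]_𝓕 the heritage property makes x an extreme point of A, so
-- F(A) ≤ π(x, A) ≤ π(x, X) by monotonicity; the default value min_𝓕 F is at
-- most F(X) ≤ π(x, X). Hence every candidate in the maximum defining π_F(x, X)
-- is bounded by π(x, X).
module Submission where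

open import Defs
open import Level using (Level)
open import Data.Bool using (Bool; true; false; T; _∧_)
open import Data.Nat using (ℕ; suc)
open import Data.Fin using (Fin)
open import Data.Fin.Subset using (Subset; _∈_; _⊆_; _-_)
open import Data.Fin.Subset.Properties using (_∈?_; _⊆?_; nonempty?)
open import Data.List using ([]; _∷_; map; foldr)
open import Data.List.Membership.Propositional using () renaming (_∈_ to _∈ₗ_)
open import Data.List.Membership.Propositional.Properties
  using (∈-map⁺; ∈-++⁺ˡ; ∈-++⁺ʳ; ∈-filter⁺; ∈-filter⁻; ∈-allFin)
open import Data.List.Relation.Unary.All using (All; []; _∷_; tabulate)
open import Data.List.Relation.Unary.All.Properties using () renaming (map⁺ to All-map⁺)
open import Data.List.Relation.Unary.Any using (here; there)
open import Data.Product using (_×_; _,_; proj₁; proj₂)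
open import Data.Sum using (inj₁; inj₂)
open import Data.Vec using () renaming ([] to []ᵥ; _∷_ to _∷ᵥ_)
open import Function using (_∘_)
open import Relation.Binary.Bundles using (DecTotalOrder)
open import Relation.Binary.PropositionalEquality using (refl)
open import Relation.Nullary using (Dec; yes; no; does; contradiction)
open import Relation.Nullary.Decidable using (T?)

module ListExtrema {c ℓ₁ ℓ₂ : Level} (O : DecTotalOrder c ℓ₁ ℓ₂) where
  open DecTotalOrder O renaming (refl to ≤-refl)
  open Linkage O

  ⊓-≤ˡ : ∀ a b → a ⊓ b ≤ a
  ⊓-≤ˡ a b with a ≤? b
  ... | yes _ = ≤-refl
  ... | no a≰b with total a b
  ...   | inj₁ a≤b = contradiction a≤b a≰b
  ...   | inj₂ b≤a = b≤a

  ⊓-≤ʳ : ∀ a b → a ⊓ b ≤ b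
  ⊓-≤ʳ a b with a ≤? b
  ... | yes a≤b = a≤b
  ... | no _ = ≤-refl

  ⊔-lub : ∀ {a b c} → a ≤ c → b ≤ c → a ⊔ b ≤ c
  ⊔-lub {a} {b} a≤c b≤c with a ≤? b
  ... | yes _ = b≤c
  ... | no _ = a≤c

  foldr-⊓-≤ : ∀ {a as b} → b ∈ₗ a ∷ as → foldr _⊓_ a as ≤ b
  foldr-⊓-≤ {as = []} (here refl) = ≤-refl
  foldr-⊓-≤ {as = c ∷ cs} (here refl) =
    trans (⊓-≤ʳ c _) (foldr-⊓-≤ {as = cs} (here refl))
  foldr-⊓-≤ {as = c ∷ cs} (there (here refl)) = ⊓-≤ˡ c _
  foldr-⊓-≤ {as = c ∷ cs} (there (there b∈cs)) =
    trans (⊓-≤ʳ c _) (foldr-⊓-≤ {as = cs} (there b∈cs))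

  foldr-⊔-lub : ∀ {a as b} → a ≤ b → All (_≤ b) as → foldr _⊔_ a as ≤ b
  foldr-⊔-lub a≤b [] = a≤b
  foldr-⊔-lub a≤b (c≤b ∷ cs≤b) = ⊔-lub c≤b (foldr-⊔-lub a≤b cs≤b)

  minOr-≤ : ∀ {d ys y} → y ∈ₗ ys → minOr d ys ≤ y
  minOr-≤ {ys = _ ∷ _} = foldr-⊓-≤

  maxOr-lub : ∀ {d ys b} → d ≤ b → All (_≤ b) ys → maxOr d ys ≤ b
  maxOr-lub d≤b [] = d≤b
  maxOr-lub _ (y≤b ∷ ys≤b) = foldr-⊔-lub y≤b ys≤b

∈-allSubsets : ∀ {n} (X : Subset n) → X ∈ₗ allSubsets n
∈-allSubsets []ᵥ = here refl
∈-allSubsets (true ∷ᵥ X) = ∈-++⁺ˡ (∈-map⁺ (true ∷ᵥ_) (∈-allSubsets X))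
∈-allSubsets {suc n} (false ∷ᵥ X) =
  ∈-++⁺ʳ (map (true ∷ᵥ_) (allSubsets n)) (∈-map⁺ (false ∷ᵥ_) (∈-allSubsets X))

does-∧⁺ : ∀ {a} {A : Set a} (a? : Dec A) {b : Bool} → A → T b → T (does a? ∧ b)
does-∧⁺ (yes _) _ t = t
does-∧⁺ (no ¬a) a _ = contradiction a ¬a

does-∧-does⁻ : ∀ {a b} {A : Set a} {B : Set b} (a? : Dec A) (b? : Dec B) →
               T (does a? ∧ does b?) → A × B
does-∧-does⁻ (yes a) (yes b) _ = a , b

module SetSystemLists {n : ℕ} (𝓕 : Subset n → Bool) where
  open SetSystem 𝓕

  ∈-familyList⁺ : ∀ {X} → X ∈𝓕 → X ∈ₗ familyList
  ∈-familyList⁺ {X} = ∈-filter⁺ (T? ∘ 𝓕) (∈-allSubsets X)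

  ∈-familyList⁻ : ∀ {X} → X ∈ₗ familyList → X ∈𝓕
  ∈-familyList⁻ X∈ = proj₂ (∈-filter⁻ (T? ∘ 𝓕) {xs = allSubsets n} X∈)

  ∈ex⇒∈-exList : ∀ {x X} → x ∈ex X → x ∈ₗ exList X
  ∈ex⇒∈-exList {x} {X} (x∈X , X-x∈𝓕) =
    ∈-filter⁺ (T? ∘ λ y → does (y ∈? X) ∧ 𝓕 (X - y)) (∈-allFin x)
      (does-∧⁺ (x ∈? X) x∈X X-x∈𝓕)

  ∈-intervalList⁻ : ∀ {x X A} → A ∈ₗ intervalList x X → A ∈𝓕 × x ∈ A × A ⊆ X
  ∈-intervalList⁻ {x} {X} {A} A∈
    with ∈-filter⁻ (T? ∘ λ B → does (x ∈? B) ∧ does (B ⊆? X)) A∈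
  ... | A∈familyList , inInterval =
    ∈-familyList⁻ A∈familyList , does-∧-does⁻ (x ∈? A) (A ⊆? X) inInterval

module πF-Bounds {c ℓ₁ ℓ₂ : Level} (O : DecTotalOrder c ℓ₁ ℓ₂) {m : ℕ}
                 (𝓕 : Subset (suc m) → Bool)
                 (π : Fin (suc m) → Subset (suc m) → DecTotalOrder.Carrier O) where
  open DecTotalOrder O
  open Linkage O
  open Construction 𝓕 π
  open SetSystem 𝓕
  open SetSystemLists 𝓕
  open ListExtrema O

  F-≤-ex : ∀ {x A} → x ∈ex A → F A ≤ π x A
  F-≤-ex {x} {A} x∈exA with nonempty? A
  ... | yes _ = minOr-≤ (∈-map⁺ (λ y → π y A) (∈ex⇒∈-exList x∈exA))
  ... | no A-empty = contradiction (x , proj₁ x∈exA) A-empty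

  minF-≤-F : ∀ {A} → A ∈𝓕 → minF ≤ F A
  minF-≤-F = minOr-≤ ∘ ∈-map⁺ F ∘ ∈-familyList⁺

  πF-lub : ∀ {x X b} → minF ≤ b → All (λ A → F A ≤ b) (intervalList x X) → πF x X ≤ b
  πF-lub {x} {X} minF≤b interval≤b with does (x ∈? X) | intervalList x X | interval≤b
  ... | true  | _ ∷ _ | As≤b = maxOr-lub minF≤b (All-map⁺ As≤b)
  ... | true  | []    | _    = minF≤b
  ... | false | _     | _    = minF≤b

mainTheorem7 : ∀ {c ℓ₁ ℓ₂ : Level} (O : DecTotalOrder c ℓ₁ ℓ₂) (m : ℕ)
    (𝓕 : Subset (suc m) → Bool)
    (π : Fin (suc m) → Subset (suc m) → DecTotalOrder.Carrier O) →
    SetSystem.NonemptySystem 𝓕 →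
    SetSystem.Accessible 𝓕 →
    SetSystem.Heritage 𝓕 →
    Linkage.Monotone O π →
    ∀ (X : Subset (suc m)) → SetSystem._∈𝓕 𝓕 X →
    ∀ (x : Fin (suc m)) → SetSystem._∈ex_ 𝓕 x X →
    DecTotalOrder._≤_ O (Linkage.Construction.πF O 𝓕 π x X) (π x X)
mainTheorem7 O m 𝓕 π _ _ heritage monotone X X∈𝓕 x x∈exX =
  πF-lub {x} {X} (trans (minF-≤-F X∈𝓕) (F-≤-ex x∈exX)) (tabulate F-≤-πxX)
  where
  open DecTotalOrder O using (_≤_; trans)
  open Linkage.Construction O 𝓕 π using (F)
  open SetSystem 𝓕 using (intervalList)
  open SetSystemLists 𝓕 using (∈-intervalList⁻)
  open πF-Bounds O 𝓕 π

  F-≤-πxX : ∀ {A} → A ∈ₗ intervalList x X → F A ≤ π x X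
  F-≤-πxX {A} A∈ with ∈-intervalList⁻ A∈
  ... | A∈𝓕 , x∈A , A⊆X =
    trans (F-≤-ex (heritage A X A∈𝓕 X∈𝓕 A⊆X x x∈exX x∈A)) (monotone x A X A⊆X)
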